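{- Let $\mathbf{L}$ be an intermediate logic, $\mathbf{LJL}_0\in\{\mathbf{LJ}_0,\mathbf{LJT}_0,\mathbf{LJ4}_0,\mathbf{LJT4}_0\}$ and $CS$ a constant specification for $\mathbf{LJL}_0$. Let $\mathsf C$ be a class of Kripke frames such that $\mathbf L$ is both strongly complete and strongly globally complete with respect to $\mathsf C$, and let $\mathsf{CKSJL}$ be the class of intuitionistic subset models over frames in $\mathsf C$ corresponding to $\mathbf{LJL}_0$ (all for $\mathbf{LJ}_0$; reflexive for $\mathbf{LJT}_0$; introspective for $\mathbf{LJ4}_0$; reflexive and introspective for $\mathbf{LJT4}_0$), and $\mathsf{CKSJL}_{CS}$ its subclass of models respecting $CS$. Then for any $\Gamma\cup\{\phi\}\subseteq\mathcal L_J$: $\Gamma\vdash_{\mathbf{LJL}_{CS}}\phi$ iff $\Gamma\models_{\mathsf{CKSJL}_{CS}}\phi$.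
   Context: Intermediate logic $\mathbf L\subsetneq\mathcal L_0$ (propositional language over $Var=\{p_i\}$ with $\bot,\land,\lor,\to$): contains all instances of the standard intuitionistic axiom schemes ($\phi\to(\psi\to\phi)$; $(\phi\to(\chi\to\psi))\to((\phi\to\chi)\to(\phi\to\psi))$; $(\phi\land\psi)\to\phi$; $(\phi\land\psi)\to\psi$; $\phi\to(\psi\to(\phi\land\psi))$; $\phi\to(\phi\lor\psi)$; $\psi\to(\phi\lor\psi)$; $(\phi\to\psi)\to((\chi\to\psi)\to((\phi\lor\chi)\to\psi))$; $\bot\to\phi$), closed under modus ponens and substitution; $\Gamma\vdash_{\mathbf L}\phi$ iff $\bigwedge_{i\le n}\gamma_i\to\phi\in\mathbf L$ for some $\gamma_i\in\Gamma$. Kripke frame: partial order; propositional Kripke model: monotone valuation with intuitionistic satisfaction. $\mathbf L$ strongly complete w.r.t. $\mathsf C$: $\Gamma\vdash_{\mathbf L}\phi$ iff at every world of every model over a frame in $\mathsf C$ where $\Gamma$ holds, $\phi$ holds; strongly globally complete: $\Gamma\vdash_{\mathbf L}\phi$ iff every model over a frame in $\mathsf C$ with $\Gamma$ true at all worlds has $\phi$ true at all worlds. Terms $Jt$: $t::=x\mid c\mid[t+t]\mid[t\cdot t]\mid\,!t$ ($x\in V=\{x_i\}$, $c\in C=\{c_i\}$); $\mathcal L_J$: $\phi::=\bot\mid p\mid\phi\land\phi\mid\phi\lor\phi\mid\phi\to\phi\mid t:\phi$. $\overline{\mathbf L}$: all $\sigma(\psi)$, $\psi\in\mathbf L$, $\sigma:Var\to\mathcal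 L_J$. Schemes $(J)$ $t:(\phi\to\psi)\to(s:\phi\to[t\cdot s]:\psi)$; $(+)$ $t:\phi\to[t+s]:\phi$, $t:\phi\to[s+t]:\phi$; $(F)$ $t:\phi\to\phi$; $(I)$ $t:\phi\to\,!t:t:\phi$. $\mathbf{LJ}_0$ = closure of $\overline{\mathbf L}\cup(J)\cup(+)$ under modus ponens; $\mathbf{LJT}_0$ adds $(F)$, $\mathbf{LJ4}_0$ adds $(I)$, $\mathbf{LJT4}_0$ both. Constant specification for $\mathbf{LJL}_0$: set of formulas $c_{i_n}:\dots:c_{i_1}:\phi$ ($n\ge1$) with $\phi\in\overline{\mathbf L}$ or an instance of a justification scheme of $\mathbf{LJL}_0$. $\Gamma\vdash_{\mathbf{LJL}_{CS}}\phi$ iff $\bigwedge_{i\le n}\gamma_i\to\phi\in\mathbf{LJL}_0$ for some $\gamma_i\in\Gamma\cup CS$ ($n\ge0$). An intuitionistic subset model over a frame $\langle F_0,\le\rangle$ is $\langle F_0,\le,F,\mathcal E,\Vdash\rangle$ with $F\supseteq F_0$, $\mathcal E:Jt\to2^{F\times F}$ (write $\mathcal E_t[x]=\{z\in F\mid(x,z)\in\mathcal E_t\}$) and $\Vdash\subseteq F\times\mathcal L_J$ such that: for $x,y\in F_0$ with $x\le y$: $x\Vdash p\Rightarrow y\Vdash p$ for $p\in Var$, and $\mathcal E_t[y]\subseteq\mathcal E_t[x]$; for every $x\in F_0$: $x\not\Vdash\bot$; $x\Vdash\phi\land\psi$ iff both; $x\Vdash\phi\lor\psi$ iff one of them; $x\Vdash\phi\to\psi$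 iff for all $y\ge x$ ($y\in F_0$), $y\not\Vdash\phi$ or $y\Vdash\psi$; $x\Vdash t:\phi$ iff $y\Vdash\phi$ for all $y\in\mathcal E_t[x]$; and for every $x\in F_0$: $\mathcal E_{[t+s]}[x]\subseteq\mathcal E_t[x]\cap\mathcal E_s[x]$ and $\mathcal E_{[t\cdot s]}[x]\subseteq\{y\in F\mid y\Vdash\phi\text{ for all }\phi\in M^x_{t,s}\}$, where $M^x_{t,s}=\{\phi\mid\exists\psi\,\forall y\in F\,(y\in\mathcal E_t[x]\Rightarrow y\Vdash\psi\to\phi,\text{ and }y\in\mathcal E_s[x]\Rightarrow y\Vdash\psi)\}$. Reflexive: $x\in\mathcal E_t[x]$ for all $x\in F_0$, $t$. Introspective: $\mathcal E_{!t}[x]\subseteq\{y\in F\mid\forall\phi\,(x\Vdash t:\phi\Rightarrow y\Vdash t:\phi)\}$ for all $x\in F_0$, $t$. Respects $CS$: $x\Vdash\chi$ for all $\chi\in CS$ and $x\in F_0$. $\Gamma\models_{\mathsf K}\phi$ iff for all models in $\mathsf K$ and all $x\in F_0$, if $x\Vdash\gamma$ for all $\gamma\in\Gamma$ then $x\Vdash\phi$. -}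

module Defs where

open import Data.Nat using (ℕ)
open import Data.List using (List; []; _∷_)
open import Data.List.Relation.Unary.All using (All)
open import Data.Product using (Σ; _×_; _,_)
open import Data.Sum using (_⊎_)
open import Data.Empty using (⊥)
open import Data.Unit using (⊤)
open import Relation.Nullary using (¬_)
open import Relation.Binary.PropositionalEquality using (_≡_)
open import Relation.Binary.Structures using (IsPartialOrder)

open import Level using (Level; _⊔_)

infix 1 _↔_
_↔_ : ∀ {a b : Level} → Set a → Set b → Set (a ⊔ b)
A ↔ B = (A → B) × (B → A)

infixr 6 _∧₀_
infixr 5 _∨₀_
infixr 4 _⇒₀_

data Fml : Set where
  ⊥₀   : Fml
  var  : ℕ → Fml
  _∧₀_ : Fml → Fml → Fml
  _∨₀_ : Fml → Fml → Fml
  _⇒₀_ : Fml → Fml → Fml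

subst₀ : (ℕ → Fml) → Fml → Fml
subst₀ σ ⊥₀ = ⊥₀
subst₀ σ (var p) = σ p
subst₀ σ (φ ∧₀ ψ) = subst₀ σ φ ∧₀ subst₀ σ ψ
subst₀ σ (φ ∨₀ ψ) = subst₀ σ φ ∨₀ subst₀ σ ψ
subst₀ σ (φ ⇒₀ ψ) = subst₀ σ φ ⇒₀ subst₀ σ ψ

data IntAxiom : Fml → Set where
  ax1 : ∀ φ ψ → IntAxiom (φ ⇒₀ (ψ ⇒₀ φ))
  ax2 : ∀ φ χ ψ → IntAxiom ((φ ⇒₀ (χ ⇒₀ ψ)) ⇒₀ ((φ ⇒₀ χ) ⇒₀ (φ ⇒₀ ψ)))
  ax3 : ∀ φ ψ → IntAxiom ((φ ∧₀ ψ) ⇒₀ φ)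
  ax4 : ∀ φ ψ → IntAxiom ((φ ∧₀ ψ) ⇒₀ ψ)
  ax5 : ∀ φ ψ → IntAxiom (φ ⇒₀ (ψ ⇒₀ (φ ∧₀ ψ)))
  ax6 : ∀ φ ψ → IntAxiom (φ ⇒₀ (φ ∨₀ ψ))
  ax7 : ∀ φ ψ → IntAxiom (ψ ⇒₀ (φ ∨₀ ψ))
  ax8 : ∀ φ ψ χ → IntAxiom ((φ ⇒₀ ψ) ⇒₀ ((χ ⇒₀ ψ) ⇒₀ ((φ ∨₀ χ) ⇒₀ ψ)))
  ax9 : ∀ φ → IntAxiom (⊥₀ ⇒₀ φ)

record IntermediateLogic (L : Fml → Set) : Set where
  field
    proper : Σ Fml (λ φ → ¬ L φ)
    axioms : ∀ φ → IntAxiom φ → L φ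
    mp     : ∀ φ ψ → L (φ ⇒₀ ψ) → L φ → L ψ
    subst  : ∀ (σ : ℕ → Fml) φ → L φ → L (subst₀ σ φ)

⋀₀ : List Fml → Fml
⋀₀ [] = ⊥₀ ⇒₀ ⊥₀
⋀₀ (γ ∷ γs) = γ ∧₀ ⋀₀ γs

_⊢[_]_ : (Fml → Set) → (Fml → Set) → Fml → Set
Γ ⊢[ L ] φ = Σ (List Fml) (λ γs → All Γ γs × L (⋀₀ γs ⇒₀ φ))

record Frame : Set₁ where
  field
    W     : Set
    _≤_   : W → W → Set
    isPO  : IsPartialOrder _≡_ _≤_

record KModel (fr : Frame) : Set₁ where
  open Frame fr
  field
    V    : ℕ → W → Set
    mono : ∀ {w v} p → w ≤ v → V p w → V p v

module _ {fr : Frame} (M : KModel fr) where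
  open Frame fr
  open KModel M
  sat : W → Fml → Set
  sat w ⊥₀ = ⊥
  sat w (var p) = V p w
  sat w (φ ∧₀ ψ) = sat w φ × sat w ψ
  sat w (φ ∨₀ ψ) = sat w φ ⊎ sat w ψ
  sat w (φ ⇒₀ ψ) = ∀ v → w ≤ v → sat v φ → sat v ψ

StronglyComplete : (Fml → Set) → (Frame → Set) → Set₁
StronglyComplete L C = ∀ (Γ : Fml → Set) φ →
  (Γ ⊢[ L ] φ) ↔
  (∀ fr → C fr → (M : KModel fr) → ∀ w →
     (∀ γ → Γ γ → sat M w γ) → sat M w φ)

StronglyGloballyComplete : (Fml → Set) → (Frame → Set) → Set₁
StronglyGloballyComplete L C = ∀ (Γ : Fml → Set) φ →
  (Γ ⊢[ L ] φ) ↔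
  (∀ fr → C fr → (M : KModel fr) →
     (∀ w γ → Γ γ → sat M w γ) → ∀ w → sat M w φ)

infixl 7 _·_
infixl 6 _+ₜ_

data Tm : Set where
  tvar  : ℕ → Tm
  tcon  : ℕ → Tm
  _+ₜ_  : Tm → Tm → Tm
  _·_   : Tm → Tm → Tm
  !_    : Tm → Tm

infixr 6 _∧_
infixr 5 _∨_
infixr 4 _⇒_
infixr 7 _∶_

data JFml : Set where
  ⊥ⱼ  : JFml
  atom : ℕ → JFml
  _∧_ : JFml → JFml → JFml
  _∨_ : JFml → JFml → JFml
  _⇒_ : JFml → JFml → JFml
  _∶_ : Tm → JFml → JFml

inst : (ℕ → JFml) → Fml → JFml
inst σ ⊥₀ = ⊥ⱼ
inst σ (var p) = σ p
inst σ (φ ∧₀ ψ) = inst σ φ ∧ inst σ ψ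
inst σ (φ ∨₀ ψ) = inst σ φ ∨ inst σ ψ
inst σ (φ ⇒₀ ψ) = inst σ φ ⇒ inst σ ψ

LBar : (Fml → Set) → JFml → Set
LBar L χ = Σ (ℕ → JFml) (λ σ → Σ Fml (λ ψ → L ψ × inst σ ψ ≡ χ))

data Variant : Set where
  LJ LJT LJ4 LJT4 : Variant

data HasT : Variant → Set where
  hasT-LJT  : HasT LJT
  hasT-LJT4 : HasT LJT4

data Has4 : Variant → Set where
  has4-LJ4  : Has4 LJ4
  has4-LJT4 : Has4 LJT4

data JAxiom (v : Variant) : JFml → Set where
  axJ  : ∀ t s φ ψ → JAxiom v ((t ∶ (φ ⇒ ψ)) ⇒ ((s ∶ φ) ⇒ ((t · s) ∶ ψ)))
  axP₁ : ∀ t s φ → JAxiom v ((t ∶ φ) ⇒ ((t +ₜ s) ∶ φ))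
  axP₂ : ∀ t s φ → JAxiom v ((t ∶ φ) ⇒ ((s +ₜ t) ∶ φ))
  axF  : HasT v → ∀ t φ → JAxiom v ((t ∶ φ) ⇒ φ)
  axI  : Has4 v → ∀ t φ → JAxiom v ((t ∶ φ) ⇒ ((! t) ∶ (t ∶ φ)))

data LJL₀ (L : Fml → Set) (v : Variant) : JFml → Set where
  base : ∀ {φ} → LBar L φ → LJL₀ L v φ
  jax  : ∀ {φ} → JAxiom v φ → LJL₀ L v φ
  mp   : ∀ {φ ψ} → LJL₀ L v (φ ⇒ ψ) → LJL₀ L v φ → LJL₀ L v ψ

data ConstChain : JFml → JFml → Set where
  one  : ∀ i φ → ConstChain (tcon i ∶ φ) φ
  more : ∀ i {χ φ} → ConstChain χ φ → ConstChain (tcon i ∶ χ) φ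

IsConstSpec : (Fml → Set) → Variant → (JFml → Set) → Set
IsConstSpec L v CS = ∀ χ → CS χ →
  Σ JFml (λ φ → ConstChain χ φ × (LBar L φ ⊎ JAxiom v φ))

⋀ : List JFml → JFml
⋀ [] = ⊥ⱼ ⇒ ⊥ⱼ
⋀ (γ ∷ γs) = γ ∧ ⋀ γs

Derives : (Fml → Set) → Variant → (JFml → Set) → (JFml → Set) → JFml → Set
Derives L v CS Γ φ =
  Σ (List JFml) (λ γs → All (λ γ → Γ γ ⊎ CS γ) γs × LJL₀ L v (⋀ γs ⇒ φ))

-- Intuitionistic subset models.  F ⊇ F₀ is represented as F = W ⊎ X,
-- with F₀ = W embedded via inj₁.

open import Data.Sum using (inj₁)

record SubsetModel (fr : Frame) : Set₁ where
  open Frame fr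
  field
    X   : Set
  F : Set
  F = W ⊎ X
  ι : W → F
  ι = inj₁
  field
    E   : Tm → F → F → Set          -- (x , z) ∈ 𝓔_t  written  E t x z
    _⊩_ : F → JFml → Set
  M : W → Tm → Tm → JFml → Set
  M x t s φ = Σ JFml (λ ψ → ∀ (y : F) →
                 (E t (ι x) y → y ⊩ (ψ ⇒ φ)) × (E s (ι x) y → y ⊩ ψ))
  field
    mono-atom : ∀ {x y} p → x ≤ y → ι x ⊩ atom p → ι y ⊩ atom p
    mono-E    : ∀ {x y} t z → x ≤ y → E t (ι y) z → E t (ι x) z
    sat-⊥     : ∀ x → ¬ (ι x ⊩ ⊥ⱼ)
    sat-∧     : ∀ x φ ψ → (ι x ⊩ (φ ∧ ψ)) ↔ (ι x ⊩ φ × ι x ⊩ ψ)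
    sat-∨     : ∀ x φ ψ → (ι x ⊩ (φ ∨ ψ)) ↔ (ι x ⊩ φ ⊎ ι x ⊩ ψ)
    sat-⇒     : ∀ x φ ψ → (ι x ⊩ (φ ⇒ ψ)) ↔
                  (∀ y → x ≤ y → ι y ⊩ φ → ι y ⊩ ψ)
    sat-∶     : ∀ x t φ → (ι x ⊩ (t ∶ φ)) ↔ (∀ y → E t (ι x) y → y ⊩ φ)
    E-+       : ∀ x t s y → E (t +ₜ s) (ι x) y → E t (ι x) y × E s (ι x) y
    E-·       : ∀ x t s y → E (t · s) (ι x) y → ∀ φ → M x t s φ → y ⊩ φ

module _ {fr : Frame} (𝓜 : SubsetModel fr) where
  open Frame fr
  open SubsetModel 𝓜

  IsReflexive : Set
  IsReflexive = ∀ x t → E t (ι x) (ι x)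

  IsIntrospective : Set
  IsIntrospective = ∀ x t y → E (! t) (ι x) y →
    ∀ φ → ι x ⊩ (t ∶ φ) → y ⊩ (t ∶ φ)

  RespectsCS : (JFml → Set) → Set
  RespectsCS CS = ∀ χ → CS χ → ∀ x → ι x ⊩ χ

ModelFor : Variant → {fr : Frame} → SubsetModel fr → Set
ModelFor LJ   𝓜 = ⊤
ModelFor LJT  𝓜 = IsReflexive 𝓜
ModelFor LJ4  𝓜 = IsIntrospective 𝓜
ModelFor LJT4 𝓜 = IsReflexive 𝓜 × IsIntrospective 𝓜

Entails : (Frame → Set) → Variant → (JFml → Set) → (JFml → Set) → JFml → Set₁
Entails C v CS Γ φ = ∀ fr → C fr → (𝓜 : SubsetModel fr) →
  ModelFor v 𝓜 → RespectsCS 𝓜 CS →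
  ∀ x → (∀ γ → Γ γ → SubsetModel._⊩_ 𝓜 (SubsetModel.ι 𝓜 x) γ) →
  SubsetModel._⊩_ 𝓜 (SubsetModel.ι 𝓜 x) φ

-- Soundness: every subset model restricted to its normal worlds F₀ is a Kripke
-- style valuation of L_J; instances of L̄ hold in it because L is sound on C,
-- and the justification schemes hold by the conditions on 𝓔.
--
-- Completeness works through the propositional skeleton: justification
-- formulas t:φ and atoms become propositional variables named by Gödel codes,
-- so that the substitution "decode a variable" maps skel χ back to χ.  If φ is
-- entailed by Γ in all subset models, then skel φ is entailed in all Kripke
-- models over C by the skeletons of Γ, CS and all LJL₀-theorems: from a Kripke
-- model and a world w satisfying these we build a valuation of L_J on the cone
-- above w, and from that valuation a canonical subset model with one extra
-- world per pair (x , t) witnessing t-evidence.  Strong completeness of L then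
-- yields an L-derivation, which the decoding substitution turns into an
-- LJL₀-derivation; finally the theorem hypotheses are discharged.
module Submission where

open import Defs
open import Data.Product using (_×_; Σ; _,_; proj₁; proj₂)
import Data.Product as Product
open import Data.Nat using (ℕ; zero; suc; _+_; z≤n; s≤s) renaming (_≤_ to _≤ℕ_)
open import Data.Nat.Properties using (≤-trans; ≤-refl; m≤n⇒m≤1+n; n≤1+n; +-suc; +-identityʳ; suc-injective)
open import Data.List using (List; []; _∷_; map)
open import Data.List.Relation.Unary.All using (All; []; _∷_)
open import Data.Sum using (_⊎_; inj₁; inj₂; [_,_]′)
import Data.Sum as Sum
open import Data.Empty using (⊥; ⊥-elim)
open import Data.Unit using (tt)
open import Function using (_∘_; id)
open import Relation.Binary.PropositionalEquality using (_≡_; refl; sym; trans; cong; cong₂; subst)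
open import Relation.Binary.Structures using (IsPartialOrder)

-- The diagonal enumeration (0,0), (1,0), (0,1), (2,0), (1,1), (0,2), … of ℕ × ℕ.
next : ℕ × ℕ → ℕ × ℕ
next (zero  , b) = suc b , zero
next (suc a , b) = a , suc b

unpair : ℕ → ℕ × ℕ
unpair zero    = 0 , 0
unpair (suc n) = next (unpair n)

-- The enumeration is onto: walk along the diagonal a + b = s towards (s , 0),
-- which is reached right after (0 , s - 1).
unpair-onto : ∀ s a b → a + b ≡ s → Σ ℕ (λ n → unpair n ≡ (a , b))
unpair-onto s       a       (suc b) e with unpair-onto s (suc a) b (trans (sym (+-suc a b)) e)
... | n , eq = suc n , cong next eq
unpair-onto zero    zero    zero    e = 0 , refl
unpair-onto (suc s) zero    zero    ()
unpair-onto zero    (suc a) zero    ()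
unpair-onto (suc s) (suc a) zero    e with unpair-onto s zero a (trans (sym (+-identityʳ a)) (suc-injective e))
... | n , eq = suc n , cong next eq

pair : ℕ → ℕ → ℕ
pair a b = proj₁ (unpair-onto (a + b) a b refl)

unpair-pair : ∀ a b → unpair (pair a b) ≡ (a , b)
unpair-pair a b = proj₂ (unpair-onto (a + b) a b refl)

-- Both components of unpair n are at most n; hence codes of subformulas are
-- bounded by the code of the formula, which makes decoding with fuel work.
unpair-bounded : ∀ n → proj₁ (unpair n) ≤ℕ n × proj₂ (unpair n) ≤ℕ n
unpair-bounded zero    = z≤n , z≤n
unpair-bounded (suc n) = next-bounded (unpair n) (unpair-bounded n)
  where
  next-bounded : ∀ p → proj₁ p ≤ℕ n × proj₂ p ≤ℕ n →
                 proj₁ (next p) ≤ℕ suc n × proj₂ (next p) ≤ℕ suc n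
  next-bounded (zero  , b) (_   , b≤n) = s≤s b≤n , z≤n
  next-bounded (suc a , b) (a<n , b≤n) = m≤n⇒m≤1+n (≤-trans (n≤1+n a) a<n) , s≤s b≤n

pair-≤ₗ : ∀ a b → a ≤ℕ pair a b
pair-≤ₗ a b = subst (λ p → proj₁ p ≤ℕ pair a b) (unpair-pair a b) (proj₁ (unpair-bounded (pair a b)))

pair-≤ᵣ : ∀ a b → b ≤ℕ pair a b
pair-≤ᵣ a b = subst (λ p → proj₂ p ≤ℕ pair a b) (unpair-pair a b) (proj₂ (unpair-bounded (pair a b)))

payload≤ : ∀ k a {f} → pair k a ≤ℕ f → a ≤ℕ f
payload≤ k a h = ≤-trans (pair-≤ᵣ k a) h

payload₁≤ : ∀ k a b {f} → pair k (pair a b) ≤ℕ f → a ≤ℕ f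
payload₁≤ k a b h = ≤-trans (pair-≤ₗ a b) (payload≤ k (pair a b) h)

payload₂≤ : ∀ k a b {f} → pair k (pair a b) ≤ℕ f → b ≤ℕ f
payload₂≤ k a b h = ≤-trans (pair-≤ᵣ a b) (payload≤ k (pair a b) h)

codeTm : Tm → ℕ
codeTm (tvar n) = suc (pair 0 n)
codeTm (tcon n) = suc (pair 1 n)
codeTm (t +ₜ s) = suc (pair 2 (pair (codeTm t) (codeTm s)))
codeTm (t · s)  = suc (pair 3 (pair (codeTm t) (codeTm s)))
codeTm (! t)    = suc (pair 4 (codeTm t))

code : JFml → ℕ
code ⊥ⱼ       = zero
code (atom p) = suc (pair 0 p)
code (a ∧ b)  = suc (pair 1 (pair (code a) (code b)))
code (a ∨ b)  = suc (pair 2 (pair (code a) (code b)))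
code (a ⇒ b)  = suc (pair 3 (pair (code a) (code b)))
code (t ∶ a)  = suc (pair 4 (pair (codeTm t) (code a)))

decodeTm : ℕ → ℕ → Tm
decodeTmNode : ℕ → ℕ → ℕ → Tm

decodeTm (suc f) (suc m) = decodeTmNode f (proj₁ (unpair m)) (proj₂ (unpair m))
decodeTm _       _       = tvar 0

decodeTmNode f 0 x = tvar x
decodeTmNode f 1 x = tcon x
decodeTmNode f 2 x = decodeTm f (proj₁ (unpair x)) +ₜ decodeTm f (proj₂ (unpair x))
decodeTmNode f 3 x = decodeTm f (proj₁ (unpair x)) · decodeTm f (proj₂ (unpair x))
decodeTmNode f 4 x = ! decodeTm f x
decodeTmNode f _ x = tvar 0

decode : ℕ → ℕ → JFml
decodeNode : ℕ → ℕ → ℕ → JFml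

decode _       zero    = ⊥ⱼ
decode zero    (suc m) = ⊥ⱼ
decode (suc f) (suc m) = decodeNode f (proj₁ (unpair m)) (proj₂ (unpair m))

decodeNode f 0 x = atom x
decodeNode f 1 x = decode f (proj₁ (unpair x)) ∧ decode f (proj₂ (unpair x))
decodeNode f 2 x = decode f (proj₁ (unpair x)) ∨ decode f (proj₂ (unpair x))
decodeNode f 3 x = decode f (proj₁ (unpair x)) ⇒ decode f (proj₂ (unpair x))
decodeNode f 4 x = decodeTm f (proj₁ (unpair x)) ∶ decode f (proj₂ (unpair x))
decodeNode f _ x = ⊥ⱼ

decodeTm-codeTm : ∀ f t → codeTm t ≤ℕ f → decodeTm f (codeTm t) ≡ t
decodeTm-codeTm (suc f) (tvar n) _ rewrite unpair-pair 0 n = refl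
decodeTm-codeTm (suc f) (tcon n) _ rewrite unpair-pair 1 n = refl
decodeTm-codeTm (suc f) (t +ₜ s) (s≤s h)
  rewrite unpair-pair 2 (pair (codeTm t) (codeTm s)) | unpair-pair (codeTm t) (codeTm s) =
  cong₂ _+ₜ_ (decodeTm-codeTm f t (payload₁≤ 2 (codeTm t) (codeTm s) h))
             (decodeTm-codeTm f s (payload₂≤ 2 (codeTm t) (codeTm s) h))
decodeTm-codeTm (suc f) (t · s) (s≤s h)
  rewrite unpair-pair 3 (pair (codeTm t) (codeTm s)) | unpair-pair (codeTm t) (codeTm s) =
  cong₂ _·_ (decodeTm-codeTm f t (payload₁≤ 3 (codeTm t) (codeTm s) h))
            (decodeTm-codeTm f s (payload₂≤ 3 (codeTm t) (codeTm s) h))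
decodeTm-codeTm (suc f) (! t) (s≤s h) rewrite unpair-pair 4 (codeTm t) =
  cong !_ (decodeTm-codeTm f t (payload≤ 4 (codeTm t) h))

decode-code : ∀ f χ → code χ ≤ℕ f → decode f (code χ) ≡ χ
decode-code f       ⊥ⱼ       _ = refl
decode-code (suc f) (atom p) _ rewrite unpair-pair 0 p = refl
decode-code (suc f) (a ∧ b) (s≤s h)
  rewrite unpair-pair 1 (pair (code a) (code b)) | unpair-pair (code a) (code b) =
  cong₂ _∧_ (decode-code f a (payload₁≤ 1 (code a) (code b) h))
            (decode-code f b (payload₂≤ 1 (code a) (code b) h))
decode-code (suc f) (a ∨ b) (s≤s h)
  rewrite unpair-pair 2 (pair (code a) (code b)) | unpair-pair (code a) (code b) =
  cong₂ _∨_ (decode-code f a (payload₁≤ 2 (code a) (code b) h))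
            (decode-code f b (payload₂≤ 2 (code a) (code b) h))
decode-code (suc f) (a ⇒ b) (s≤s h)
  rewrite unpair-pair 3 (pair (code a) (code b)) | unpair-pair (code a) (code b) =
  cong₂ _⇒_ (decode-code f a (payload₁≤ 3 (code a) (code b) h))
            (decode-code f b (payload₂≤ 3 (code a) (code b) h))
decode-code (suc f) (t ∶ a) (s≤s h)
  rewrite unpair-pair 4 (pair (codeTm t) (code a)) | unpair-pair (codeTm t) (code a) =
  cong₂ _∶_ (decodeTm-codeTm f t (payload₁≤ 4 (codeTm t) (code a) h))
            (decode-code f a (payload₂≤ 4 (codeTm t) (code a) h))

skel : JFml → Fml
skel ⊥ⱼ       = ⊥₀
skel (atom p) = var (code (atom p))
skel (a ∧ b)  = skel a ∧₀ skel b
skel (a ∨ b)  = skel a ∨₀ skel b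
skel (a ⇒ b)  = skel a ⇒₀ skel b
skel (t ∶ a)  = var (code (t ∶ a))

decodeVar : ℕ → JFml
decodeVar n = decode n n

inst-skel : ∀ χ → inst decodeVar (skel χ) ≡ χ
inst-skel ⊥ⱼ       = refl
inst-skel (atom p) = decode-code _ (atom p) ≤-refl
inst-skel (a ∧ b)  = cong₂ _∧_ (inst-skel a) (inst-skel b)
inst-skel (a ∨ b)  = cong₂ _∨_ (inst-skel a) (inst-skel b)
inst-skel (a ⇒ b)  = cong₂ _⇒_ (inst-skel a) (inst-skel b)
inst-skel (t ∶ a)  = decode-code _ (t ∶ a) ≤-refl

inst-skel-⋀ : ∀ χs → inst decodeVar (⋀₀ (map skel χs)) ≡ ⋀ χs
inst-skel-⋀ []       = refl
inst-skel-⋀ (χ ∷ χs) = cong₂ _∧_ (inst-skel χ) (inst-skel-⋀ χs)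

module FrameOrder (fr : Frame) where
  open Frame fr public

  ≤refl : ∀ {x} → x ≤ x
  ≤refl = IsPartialOrder.refl isPO

  ≤trans : ∀ {x y z} → x ≤ y → y ≤ z → x ≤ z
  ≤trans = IsPartialOrder.trans isPO

module _ {fr : Frame} (M : KModel fr) where
  open FrameOrder fr

  sat-mono : ∀ ψ {x y} → x ≤ y → sat M x ψ → sat M y ψ
  sat-mono ⊥₀       le h          = h
  sat-mono (var p)  le h          = KModel.mono M p le h
  sat-mono (a ∧₀ b) le (ha , hb)  = sat-mono a le ha , sat-mono b le hb
  sat-mono (a ∨₀ b) le (inj₁ h)   = inj₁ (sat-mono a le h)
  sat-mono (a ∨₀ b) le (inj₂ h)   = inj₂ (sat-mono b le h)
  sat-mono (a ⇒₀ b) le h          = λ z yz → h z (≤trans le yz)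

  sat-mp : ∀ {a b x} → sat M x (a ⇒₀ b) → sat M x a → sat M x b
  sat-mp {x = x} h ha = h x ≤refl ha

-- Both subset models and the completeness construction give such valuations.
record Valuation (fr : Frame) : Set₁ where
  open Frame fr
  field
    _⊨_  : W → JFml → Set
    ⊨-mono : ∀ χ {x y} → x ≤ y → x ⊨ χ → y ⊨ χ
    ⊨-⊥  : ∀ x → x ⊨ ⊥ⱼ → ⊥
    ⊨-∧  : ∀ x a b → x ⊨ (a ∧ b) ↔ (x ⊨ a × x ⊨ b)
    ⊨-∨  : ∀ x a b → x ⊨ (a ∨ b) ↔ (x ⊨ a ⊎ x ⊨ b)
    ⊨-⇒  : ∀ x a b → x ⊨ (a ⇒ b) ↔ (∀ y → x ≤ y → y ⊨ a → y ⊨ b)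

module ValuationFacts {fr : Frame} (J : Valuation fr) where
  open FrameOrder fr
  open Valuation J

  ⊨-mp : ∀ {x a b} → x ⊨ (a ⇒ b) → x ⊨ a → x ⊨ b
  ⊨-mp {x} {a} {b} h ha = proj₁ (⊨-⇒ x a b) h x ≤refl ha

  kripke : (ℕ → JFml) → KModel fr
  kripke σ = record { V = λ n x → x ⊨ σ n ; mono = λ n → ⊨-mono (σ n) }

  sat-inst : ∀ σ ψ x → sat (kripke σ) x ψ ↔ x ⊨ inst σ ψ
  sat-inst σ ⊥₀       x = (λ ()) , ⊨-⊥ x
  sat-inst σ (var p)  x = id , id
  sat-inst σ (a ∧₀ b) x =
    proj₂ (⊨-∧ x _ _) ∘ Product.map (proj₁ (sat-inst σ a x)) (proj₁ (sat-inst σ b x)) ,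
    Product.map (proj₂ (sat-inst σ a x)) (proj₂ (sat-inst σ b x)) ∘ proj₁ (⊨-∧ x _ _)
  sat-inst σ (a ∨₀ b) x =
    proj₂ (⊨-∨ x _ _) ∘ Sum.map (proj₁ (sat-inst σ a x)) (proj₁ (sat-inst σ b x)) ,
    Sum.map (proj₂ (sat-inst σ a x)) (proj₂ (sat-inst σ b x)) ∘ proj₁ (⊨-∨ x _ _)
  sat-inst σ (a ⇒₀ b) x =
    (λ h → proj₂ (⊨-⇒ x _ _) λ y le ha →
       proj₁ (sat-inst σ b y) (h y le (proj₂ (sat-inst σ a y) ha))) ,
    (λ h y le ha → proj₂ (sat-inst σ b y)
       (proj₁ (⊨-⇒ x _ _) h y le (proj₁ (sat-inst σ a y) ha)))

a₀ b₀ c₀ : Fml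
a₀ = var 0
b₀ = var 1
c₀ = var 2

curry₀ uncurry₀ discharge₀ : Fml
curry₀     = ((a₀ ∧₀ b₀) ⇒₀ c₀) ⇒₀ (b₀ ⇒₀ (a₀ ⇒₀ c₀))
uncurry₀   = (b₀ ⇒₀ (a₀ ⇒₀ c₀)) ⇒₀ ((a₀ ∧₀ b₀) ⇒₀ c₀)
discharge₀ = a₀ ⇒₀ ((b₀ ⇒₀ (a₀ ⇒₀ c₀)) ⇒₀ (b₀ ⇒₀ c₀))

module Tautologies {fr : Frame} (M : KModel fr) where
  open FrameOrder fr

  curry-valid : ∀ w → sat M w curry₀
  curry-valid w y _ h z yz hb u zu ha = h u (≤trans yz zu) (ha , sat-mono M b₀ zu hb)

  uncurry-valid : ∀ w → sat M w uncurry₀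
  uncurry-valid w y _ h z yz (ha , hb) = h z yz hb z ≤refl ha

  discharge-valid : ∀ w → sat M w discharge₀
  discharge-valid w y _ ha z yz h u zu hb = h u zu hb u ≤refl (sat-mono M a₀ (≤trans yz zu) ha)

σ₃ : JFml → JFml → JFml → ℕ → JFml
σ₃ A B C zero          = A
σ₃ A B C (suc zero)    = B
σ₃ A B C (suc (suc _)) = C

reflexive-of : ∀ {v fr} {𝓜 : SubsetModel fr} → HasT v → ModelFor v 𝓜 → IsReflexive 𝓜
reflexive-of hasT-LJT  m = m
reflexive-of hasT-LJT4 m = proj₁ m

introspective-of : ∀ {v fr} {𝓜 : SubsetModel fr} → Has4 v → ModelFor v 𝓜 → IsIntrospective 𝓜
introspective-of has4-LJ4  m = m
introspective-of has4-LJT4 m = proj₂ m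

modelFor : ∀ v {fr} {𝓜 : SubsetModel fr} →
           (HasT v → IsReflexive 𝓜) → (Has4 v → IsIntrospective 𝓜) → ModelFor v 𝓜
modelFor LJ   r i = tt
modelFor LJT  r i = r hasT-LJT
modelFor LJ4  r i = i has4-LJ4
modelFor LJT4 r i = r hasT-LJT4 , i has4-LJT4

module SubsetModelFacts {fr : Frame} (𝓜 : SubsetModel fr) where
  open FrameOrder fr
  open SubsetModel 𝓜

  ⊩-mono : ∀ χ {x y} → x ≤ y → ι x ⊩ χ → ι y ⊩ χ
  ⊩-mono ⊥ⱼ {x} le h = ⊥-elim (sat-⊥ x h)
  ⊩-mono (atom p) le h = mono-atom p le h
  ⊩-mono (a ∧ b) {x} {y} le h =
    proj₂ (sat-∧ y a b) (Product.map (⊩-mono a le) (⊩-mono b le) (proj₁ (sat-∧ x a b) h))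
  ⊩-mono (a ∨ b) {x} {y} le h =
    proj₂ (sat-∨ y a b) (Sum.map (⊩-mono a le) (⊩-mono b le) (proj₁ (sat-∨ x a b) h))
  ⊩-mono (a ⇒ b) {x} {y} le h =
    proj₂ (sat-⇒ y a b) (λ z yz → proj₁ (sat-⇒ x a b) h z (≤trans le yz))
  ⊩-mono (t ∶ a) {x} {y} le h =
    proj₂ (sat-∶ y t a) (λ z e → proj₁ (sat-∶ x t a) h z (mono-E t z le e))

  valuation : Valuation fr
  valuation = record { _⊨_ = λ x χ → ι x ⊩ χ ; ⊨-mono = ⊩-mono ; ⊨-⊥ = sat-⊥
                     ; ⊨-∧ = sat-∧ ; ⊨-∨ = sat-∨ ; ⊨-⇒ = sat-⇒ }

  ⇒-intro : ∀ {x a b} → (∀ y → x ≤ y → ι y ⊩ a → ι y ⊩ b) → ι x ⊩ (a ⇒ b)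
  ⇒-intro {x} {a} {b} = proj₂ (sat-⇒ x a b)

  ∶-intro : ∀ {x t a} → (∀ y → E t (ι x) y → y ⊩ a) → ι x ⊩ (t ∶ a)
  ∶-intro {x} {t} {a} = proj₂ (sat-∶ x t a)

  ∶-elim : ∀ {x t a} → ι x ⊩ (t ∶ a) → ∀ y → E t (ι x) y → y ⊩ a
  ∶-elim {x} {t} {a} = proj₁ (sat-∶ x t a)

  -- (J) and (+) hold by the conditions on 𝓔, (F) by reflexivity, (I) by introspection.
  axiom-sound : ∀ {v} → ModelFor v 𝓜 → ∀ χ → JAxiom v χ → ∀ x → ι x ⊩ χ
  axiom-sound m _ (axJ t s φ ψ) x = ⇒-intro λ y _ h₁ → ⇒-intro λ z yz h₂ → ∶-intro λ u e →
    E-· z t s u e ψ (φ , λ y′ → ∶-elim (⊩-mono (t ∶ (φ ⇒ ψ)) yz h₁) y′ , ∶-elim h₂ y′)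
  axiom-sound m _ (axP₁ t s φ) x = ⇒-intro λ y _ h → ∶-intro λ u e → ∶-elim h u (proj₁ (E-+ y t s u e))
  axiom-sound m _ (axP₂ t s φ) x = ⇒-intro λ y _ h → ∶-intro λ u e → ∶-elim h u (proj₂ (E-+ y s t u e))
  axiom-sound m _ (axF hT t φ) x = ⇒-intro λ y _ h → ∶-elim h (ι y) (reflexive-of hT m y t)
  axiom-sound m _ (axI h4 t φ) x = ⇒-intro λ y _ h → ∶-intro λ u e → introspective-of h4 m y t u e φ h

  hypotheses-sound : ∀ {Γ CS : JFml → Set} {x} → RespectsCS 𝓜 CS → (∀ γ → Γ γ → ι x ⊩ γ) →
                     ∀ γs → All (λ γ → Γ γ ⊎ CS γ) γs → ι x ⊩ ⋀ γs
  hypotheses-sound rcs hΓ []       []       = ⇒-intro λ y _ h → h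
  hypotheses-sound {x = x} rcs hΓ (γ ∷ γs) (p ∷ ps) =
    proj₂ (sat-∧ x γ (⋀ γs)) ([ hΓ γ , (λ c → rcs γ c x) ]′ p , hypotheses-sound rcs hΓ γs ps)

-- The canonical subset model of a valuation validating the justification
-- schemes of v: besides the normal worlds W it has a world (x , t) for every
-- x and t, forcing exactly what t justifies at x.  The t-successors of x are
-- the worlds forcing everything t justifies at x; (x , t) is one of them, so
-- t:φ is forced at x iff x ⊨ t:φ.
module CanonicalModel {fr : Frame} (J : Valuation fr) (v : Variant)
       (axioms-valid : ∀ χ → JAxiom v χ → ∀ x → Valuation._⊨_ J x χ) where
  open Frame fr
  open Valuation J
  open ValuationFacts J

  _⊩_ : W ⊎ (W × Tm) → JFml → Set
  inj₁ x       ⊩ χ = x ⊨ χ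
  inj₂ (x , t) ⊩ χ = x ⊨ (t ∶ χ)

  E : Tm → W ⊎ (W × Tm) → W ⊎ (W × Tm) → Set
  E t (inj₁ x) y = ∀ χ → x ⊨ (t ∶ χ) → y ⊩ χ
  E t (inj₂ _) y = ⊥

  model : SubsetModel fr
  model = record
    { X         = W × Tm
    ; E         = E
    ; _⊩_       = _⊩_
    ; mono-atom = λ p → ⊨-mono (atom p)
    ; mono-E    = λ t z le e χ h → e χ (⊨-mono (t ∶ χ) le h)
    ; sat-⊥     = ⊨-⊥
    ; sat-∧     = ⊨-∧
    ; sat-∨     = ⊨-∨
    ; sat-⇒     = ⊨-⇒
    ; sat-∶     = λ x t φ → (λ h y e → e φ h) , (λ g → g (inj₂ (x , t)) (λ χ h → h))
    ; E-+       = λ x t s y e → (λ χ h → e χ (⊨-mp (axioms-valid _ (axP₁ t s χ) x) h))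
                              , (λ χ h → e χ (⊨-mp (axioms-valid _ (axP₂ s t χ) x) h))
    ; E-·       = λ { x t s y e φ (ψ , m) → e φ
                    (⊨-mp (⊨-mp (axioms-valid _ (axJ t s ψ φ) x)
                                (proj₁ (m (inj₂ (x , t))) (λ χ h → h)))
                          (proj₂ (m (inj₂ (x , s))) (λ χ h → h))) }
    }

  model-for : ModelFor v model
  model-for = modelFor v
    (λ hT x t χ h → ⊨-mp (axioms-valid _ (axF hT t χ) x) h)
    (λ h4 x t y e φ h → e (t ∶ φ) (⊨-mp (axioms-valid _ (axI h4 t φ) x) h))

module Logic (L : Fml → Set) (IL : IntermediateLogic L)
             (C : Frame → Set) (SC : StronglyComplete L C) where
  open IntermediateLogic IL renaming (mp to L-mp)

  ∅ : Fml → Set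
  ∅ _ = ⊥

  -- Theorems of L are true in all Kripke models over C (soundness half of
  -- strong completeness, for Γ = ∅).
  L-valid : ∀ ψ → L ψ → ∀ fr → C fr → (M : KModel fr) → ∀ w → sat M w ψ
  L-valid ψ l fr cfr M w =
    proj₁ (SC ∅ ψ) ([] , [] , L-mp _ _ (axioms _ (ax1 ψ (⊥₀ ⇒₀ ⊥₀))) l) fr cfr M w (λ γ ())

  L-contains-valid : ∀ ψ → (∀ fr (M : KModel fr) w → sat M w ψ) → L ψ
  L-contains-valid ψ h with proj₂ (SC ∅ ψ) (λ fr _ M w _ → h fr M w)
  ... | [] , [] , l = L-mp _ _ l (axioms _ (ax9 ⊥₀))

  LBar-valid : ∀ {fr} → C fr → (J : Valuation fr) → ∀ φ → LBar L φ → ∀ x → Valuation._⊨_ J x φ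
  LBar-valid {fr} cfr J _ (σ , ψ , l , refl) x =
    proj₁ (sat-inst σ ψ x) (L-valid ψ l fr cfr (kripke σ) x)
    where open ValuationFacts J

  module _ {v : Variant} where
    curryJ : ∀ A B C → LJL₀ L v (((A ∧ B) ⇒ C) ⇒ (B ⇒ (A ⇒ C)))
    curryJ A B C = base (σ₃ A B C , curry₀ , L-contains-valid _ (λ _ → Tautologies.curry-valid) , refl)

    uncurryJ : ∀ A B C → LJL₀ L v ((B ⇒ (A ⇒ C)) ⇒ ((A ∧ B) ⇒ C))
    uncurryJ A B C = base (σ₃ A B C , uncurry₀ , L-contains-valid _ (λ _ → Tautologies.uncurry-valid) , refl)

    dischargeJ : ∀ A B C → LJL₀ L v (A ⇒ ((B ⇒ (A ⇒ C)) ⇒ (B ⇒ C)))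
    dischargeJ A B C = base (σ₃ A B C , discharge₀ , L-contains-valid _ (λ _ → Tautologies.discharge-valid) , refl)

    discharge-theorems : ∀ {Δ : JFml → Set} χs → All (λ χ → Δ χ ⊎ LJL₀ L v χ) χs →
                         ∀ ψ → LJL₀ L v (⋀ χs ⇒ ψ) →
                         Σ (List JFml) (λ δs → All Δ δs × LJL₀ L v (⋀ δs ⇒ ψ))
    discharge-theorems []       []       ψ d = [] , [] , d
    discharge-theorems (χ ∷ χs) (p ∷ ps) ψ d
      with discharge-theorems χs ps (χ ⇒ ψ) (mp (curryJ χ (⋀ χs) ψ) d)
    ... | δs , δs∈Δ , d′ with p
    ...   | inj₁ χ∈Δ = χ ∷ δs , χ∈Δ ∷ δs∈Δ , mp (uncurryJ χ (⋀ δs) ψ) d′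
    ...   | inj₂ ⊢χ  = δs , δs∈Δ , mp (mp (dischargeJ χ (⋀ δs) ψ) ⊢χ) d′

  theorem-sound : ∀ {v fr} → C fr → (𝓜 : SubsetModel fr) → ModelFor v 𝓜 →
                  ∀ χ → LJL₀ L v χ → ∀ x → SubsetModel._⊩_ 𝓜 (SubsetModel.ι 𝓜 x) χ
  theorem-sound cfr 𝓜 m χ (base lb) x = LBar-valid cfr (SubsetModelFacts.valuation 𝓜) χ lb x
  theorem-sound cfr 𝓜 m χ (jax ax)  x = SubsetModelFacts.axiom-sound 𝓜 m χ ax x
  theorem-sound cfr 𝓜 m χ (mp d e)  x =
    ValuationFacts.⊨-mp (SubsetModelFacts.valuation 𝓜) (theorem-sound cfr 𝓜 m _ d x) (theorem-sound cfr 𝓜 m _ e x)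

  soundness : ∀ v CS Γ φ → Derives L v CS Γ φ → Entails C v CS Γ φ
  soundness v CS Γ φ (γs , γs-hyp , d) fr cfr 𝓜 m rcs x hΓ =
    ValuationFacts.⊨-mp (SubsetModelFacts.valuation 𝓜)
      (theorem-sound cfr 𝓜 m _ d x) (SubsetModelFacts.hypotheses-sound 𝓜 rcs hΓ γs γs-hyp)

  -- Given a Kripke model over C and a world w at which the skeletons of all
  -- LJL₀-theorems hold, a valuation of L_J on the frame that agrees with the
  -- skeleton above w.
  module Cone (v : Variant) {fr : Frame} (cfr : C fr) (M : KModel fr) (w : Frame.W fr)
              (theorems-at-w : ∀ χ → LJL₀ L v χ → sat M w (skel χ)) where
    open FrameOrder fr

    above : W → JFml → Set
    above x χ = ∀ z → x ≤ z → w ≤ z → sat M z (skel χ)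

    _⊨_ : W → JFml → Set
    x ⊨ ⊥ⱼ      = ⊥
    x ⊨ atom p  = above x (atom p)
    x ⊨ (a ∧ b) = x ⊨ a × x ⊨ b
    x ⊨ (a ∨ b) = x ⊨ a ⊎ x ⊨ b
    x ⊨ (a ⇒ b) = ∀ y → x ≤ y → y ⊨ a → y ⊨ b
    x ⊨ (t ∶ a) = above x (t ∶ a) × (HasT v → x ⊨ a)

    above-mono : ∀ χ {x y} → x ≤ y → above x χ → above y χ
    above-mono χ le h z yz = h z (≤trans le yz)

    ⊨-mono : ∀ χ {x y} → x ≤ y → x ⊨ χ → y ⊨ χ
    ⊨-mono ⊥ⱼ       le h          = h
    ⊨-mono (atom p) le h          = above-mono (atom p) le h
    ⊨-mono (a ∧ b)  le (ha , hb)  = ⊨-mono a le ha , ⊨-mono b le hb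
    ⊨-mono (a ∨ b)  le (inj₁ h)   = inj₁ (⊨-mono a le h)
    ⊨-mono (a ∨ b)  le (inj₂ h)   = inj₂ (⊨-mono b le h)
    ⊨-mono (a ⇒ b)  le h          = λ z yz → h z (≤trans le yz)
    ⊨-mono (t ∶ a)  le (u , f)    = above-mono (t ∶ a) le u , ⊨-mono a le ∘ f

    valuation : Valuation fr
    valuation = record { _⊨_ = _⊨_ ; ⊨-mono = ⊨-mono ; ⊨-⊥ = λ x → id
                       ; ⊨-∧ = λ x a b → id , id ; ⊨-∨ = λ x a b → id , id
                       ; ⊨-⇒ = λ x a b → id , id }

    theorem-at : ∀ {χ z} → LJL₀ L v χ → w ≤ z → sat M z (skel χ)
    theorem-at {χ} d wz = sat-mono M (skel χ) wz (theorems-at-w χ d)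

    theorem-mp : ∀ {a b z} → LJL₀ L v (a ⇒ b) → w ≤ z → sat M z (skel a) → sat M z (skel b)
    theorem-mp {a} {b} d wz = sat-mp M {skel a} {skel b} (theorem-at d wz)

    theorem-above : ∀ {a b x} → LJL₀ L v (a ⇒ b) → above x a → above x b
    theorem-above d h z xz wz = theorem-mp d wz (h z xz wz)

    theorem-above₂ : ∀ {a b c x} → LJL₀ L v (a ⇒ (b ⇒ c)) → above x a → above x b → above x c
    theorem-above₂ {b = b} {c = c} d ha hb z xz wz =
      sat-mp M {skel b} {skel c} (theorem-mp d wz (ha z xz wz)) (hb z xz wz)

    agree : ∀ χ x → w ≤ x → sat M x (skel χ) ↔ x ⊨ χ
    agree ⊥ⱼ       x wx = id , id
    agree (atom p) x wx = (λ h z xz _ → sat-mono M (skel (atom p)) xz h) , (λ h → h x ≤refl wx)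
    agree (a ∧ b)  x wx = Product.map (proj₁ (agree a x wx)) (proj₁ (agree b x wx))
                        , Product.map (proj₂ (agree a x wx)) (proj₂ (agree b x wx))
    agree (a ∨ b)  x wx = Sum.map (proj₁ (agree a x wx)) (proj₁ (agree b x wx))
                        , Sum.map (proj₂ (agree a x wx)) (proj₂ (agree b x wx))
    agree (a ⇒ b)  x wx =
      (λ h y xy → proj₁ (agree b y (≤trans wx xy)) ∘ h y xy ∘ proj₂ (agree a y (≤trans wx xy))) ,
      (λ h y xy → proj₂ (agree b y (≤trans wx xy)) ∘ h y xy ∘ proj₁ (agree a y (≤trans wx xy)))
    agree (t ∶ a)  x wx =
      (λ h → (λ z xz _ → sat-mono M (skel (t ∶ a)) xz h) ,
             (λ hT → proj₁ (agree a x wx) (theorem-mp (jax (axF hT t a)) wx h))) ,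
      (λ h → proj₁ h x ≤refl wx)

    axiom-valid : ∀ χ → JAxiom v χ → ∀ x → x ⊨ χ
    axiom-valid _ (axJ t s φ ψ) x y _ (u₁ , f₁) z yz (u₂ , f₂) =
      theorem-above₂ (jax (axJ t s φ ψ)) (above-mono (t ∶ (φ ⇒ ψ)) yz u₁) u₂ ,
      λ hT → ⊨-mono (φ ⇒ ψ) yz (f₁ hT) z ≤refl (f₂ hT)
    axiom-valid _ (axP₁ t s φ) x y _ (u , f) = theorem-above (jax (axP₁ t s φ)) u , f
    axiom-valid _ (axP₂ t s φ) x y _ (u , f) = theorem-above (jax (axP₂ t s φ)) u , f
    axiom-valid _ (axF hT t φ) x y _ (u , f) = f hT
    axiom-valid _ (axI h4 t φ) x y _ (u , f) = theorem-above (jax (axI h4 t φ)) u , λ _ → u , f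

    theorem-valid : ∀ χ → LJL₀ L v χ → ∀ x → x ⊨ χ
    theorem-valid χ (base lb) x = LBar-valid cfr valuation χ lb x
    theorem-valid χ (jax ax)  x = axiom-valid χ ax x
    theorem-valid χ (mp d e)  x = theorem-valid _ d x x ≤refl (theorem-valid _ e x)

    -- A constant chain c:…:c:φ over a valid φ holds wherever its skeleton
    -- holds above w; in the factive variants (F) peels off one constant.
    chain-valid : ∀ {χ φ} → ConstChain χ φ → (∀ x → x ⊨ φ) → ∀ x → above x χ → x ⊨ χ
    chain-valid (one i φ)      φ-valid x u = u , λ _ → φ-valid x
    chain-valid (more i {χ} c) φ-valid x u =
      u , λ hT → chain-valid c φ-valid x (theorem-above (jax (axF hT (tcon i) χ)) u)

    constSpec-valid : ∀ {CS} → IsConstSpec L v CS → (∀ χ → CS χ → sat M w (skel χ)) →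
                      ∀ χ → CS χ → ∀ x → x ⊨ χ
    constSpec-valid isCS cs-at-w χ c x with isCS χ c
    ... | φ , chain , φ∈ =
      chain-valid chain (λ y → [ (λ lb → LBar-valid cfr valuation φ lb y) , (λ ax → axiom-valid φ ax y) ]′ φ∈)
        x (λ z _ wz → sat-mono M (skel χ) wz (cs-at-w χ c))

  module Completeness (v : Variant) (CS : JFml → Set) (isCS : IsConstSpec L v CS)
                      (Γ : JFml → Set) where

    Assumption : JFml → Set
    Assumption χ = (Γ χ ⊎ CS χ) ⊎ LJL₀ L v χ

    Γ₀ : Fml → Set
    Γ₀ γ = Σ JFml (λ χ → Assumption χ × skel χ ≡ γ)

    -- Semantic step: entailment in subset models yields entailment of the
    -- skeleton in Kripke models over C, via the cone valuation and its
    -- canonical subset model.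
    skeleton-entailed : ∀ φ → Entails C v CS Γ φ → ∀ fr → C fr → (M : KModel fr) → ∀ w →
                        (∀ γ → Γ₀ γ → sat M w γ) → sat M w (skel φ)
    skeleton-entailed φ ent fr cfr M w H =
      proj₂ (agree φ w ≤refl) (ent fr cfr model model-for respects w Γ-at-w)
      where
      open FrameOrder fr using (≤refl)
      assumption-at-w : ∀ χ → Assumption χ → sat M w (skel χ)
      assumption-at-w χ a = H (skel χ) (χ , a , refl)
      open Cone v cfr M w (λ χ d → assumption-at-w χ (inj₂ d))
      open CanonicalModel valuation v axiom-valid
      respects : RespectsCS model CS
      respects = constSpec-valid isCS (λ χ c → assumption-at-w χ (inj₁ (inj₂ c)))
      Γ-at-w : ∀ γ → Γ γ → w ⊨ γ
      Γ-at-w γ g = proj₁ (agree γ w ≤refl) (assumption-at-w γ (inj₁ (inj₁ g)))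

    skeleton-preimage : ∀ γs → All Γ₀ γs → Σ (List JFml) (λ χs → All Assumption χs × map skel χs ≡ γs)
    skeleton-preimage []       []                   = [] , [] , refl
    skeleton-preimage (γ ∷ γs) ((χ , a , eq) ∷ ps) with skeleton-preimage γs ps
    ... | χs , as , eqs = χ ∷ χs , a ∷ as , cong₂ _∷_ eq eqs

    completeness : ∀ φ → Entails C v CS Γ φ → Derives L v CS Γ φ
    completeness φ ent with proj₂ (SC Γ₀ (skel φ)) (skeleton-entailed φ ent)
    ... | γs , γs∈Γ₀ , l with skeleton-preimage γs γs∈Γ₀
    ...   | χs , χs-assumed , refl =
      discharge-theorems χs χs-assumed φ
        (base (decodeVar , _ , l , cong₂ _⇒_ (inst-skel-⋀ χs) (inst-skel φ)))

mainTheorem7 : (L : Fml → Set) → IntermediateLogic L →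
    (v : Variant) → (CS : JFml → Set) → IsConstSpec L v CS →
    (C : Frame → Set) → StronglyComplete L C → StronglyGloballyComplete L C →
    (Γ : JFml → Set) → (φ : JFml) →
    (Derives L v CS Γ φ → Entails C v CS Γ φ) × (Entails C v CS Γ φ → Derives L v CS Γ φ)
mainTheorem7 L IL v CS isCS C SC _ Γ φ =
  soundness v CS Γ φ , Completeness.completeness v CS isCS Γ φ
  where open Logic L IL C SC
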